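{- For every $a\in\mathbb{N}\setminus\{0\}$, $\beta(f_a-1)=\left\lfloor\frac{a-1}{2}\right\rfloor$.
   Context: $\{f_n\}$ is the Fibonacci sequence ($f_0=0$, $f_1=1$, $f_{n+2}=f_{n+1}+f_n$). For $x\in\mathbb{N}$, $\beta(x)=\min\{\sum_{i=2}^{l} b_i \mid x=\sum_{i=2}^{l} b_i f_i,\ (b_2,\ldots,b_l)\in\mathbb{N}^{l-1},\ l\geq 2\}$ (so $\beta(0)=0$). -}

module Defs where

open import Data.Nat using (ℕ; zero; suc; _+_; _*_; _≤_)
open import Data.Vec using (Vec; []; _∷_)
open import Data.Product using (Σ; _×_)
open import Relation.Binary.PropositionalEquality using (_≡_)

fib : ℕ → ℕ
fib zero = 0
fib (suc zero) = 1
fib (suc (suc n)) = fib (suc n) + fib n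

valueFrom : ℕ → {m : ℕ} → Vec ℕ m → ℕ
valueFrom k [] = 0
valueFrom k (b ∷ bs) = b * fib k + valueFrom (suc k) bs

weight : {m : ℕ} → Vec ℕ m → ℕ
weight [] = 0
weight (b ∷ bs) = b + weight bs

IsBeta : ℕ → ℕ → Set
IsBeta x k =
  Σ ℕ (λ m → Σ (Vec ℕ (suc m)) λ bs → (valueFrom 2 bs ≡ x) × (weight bs ≡ k))
  × (∀ (m : ℕ) (bs : Vec ℕ (suc m)) → valueFrom 2 bs ≡ x → k ≤ weight bs)

{-# OPTIONS --safe #-}
module Submission where

open import Defs
open import Data.Nat using (ℕ; zero; suc; _+_; _*_; _∸_; _/_; _⊔_; _≤_; _<_; _<?_; z≤n; s≤s; s≤s⁻¹)
open import Data.Nat.Properties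
open import Data.Nat.DivMod using (m/n≡1+[m∸n]/n)
open import Data.Nat.Tactic.RingSolver using (solve-∀)
open import Data.Vec using (Vec; []; _∷_)
open import Data.Product using (Σ; _×_; _,_)
open import Data.Sum using (inj₁; inj₂)
open import Data.Empty using (⊥-elim)
open import Relation.Nullary using (yes; no)
open import Relation.Binary.Definitions using (tri<; tri≈; tri>)
open import Relation.Binary.PropositionalEquality
  using (_≡_; _≢_; refl; sym; trans; cong; subst; subst₂; module ≡-Reasoning)

-- β(x) is the number of terms of the greedy (Zeckendorf) expansion of x.  Adding one
-- Fibonacci number to a greedy expansion yields one that is at most one term longer
-- (carries use f(n) + f(n+1) = f(n+2) and 2 f(n+2) = f(n+3) + f(n)), so a representation
-- of weight w gives a greedy expansion of at most w terms, while the greedy expansion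
-- itself is a representation.  Finally f(a) - 1 = f(a-1) + f(a-3) + … greedily, with
-- ⌊(a-1)/2⌋ terms.

fib-≤-suc : ∀ n → fib n ≤ fib (suc n)
fib-≤-suc zero    = z≤n
fib-≤-suc (suc n) = m≤m+n (fib (suc n)) (fib n)

fib-mono-≤ : ∀ {m n} → m ≤ n → fib m ≤ fib n
fib-mono-≤ {n = zero} z≤n = ≤-refl
fib-mono-≤ {n = suc n} m≤1+n with m≤n⇒m<n∨m≡n m≤1+n
... | inj₁ m<1+n = ≤-trans (fib-mono-≤ (s≤s⁻¹ m<1+n)) (fib-≤-suc n)
... | inj₂ refl  = ≤-refl

fib-suc-pos : ∀ n → 0 < fib (suc n)
fib-suc-pos zero    = s≤s z≤n
fib-suc-pos (suc n) = <-≤-trans (fib-suc-pos n) (fib-≤-suc (suc n))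

-- r < fib n makes fib (suc n) the largest Fibonacci number ≤ fib (suc n) + r, so
-- Zeckendorf x k says that the greedy expansion of x has k terms.
data Zeckendorf : ℕ → ℕ → Set where
  empty : Zeckendorf 0 0
  cons  : ∀ {n r k} → r < fib n → Zeckendorf r k → Zeckendorf (fib (suc n) + r) (suc k)

zeck-cast : ∀ {x y k} → x ≡ y → Zeckendorf x k → Zeckendorf y k
zeck-cast refl z = z

cons-positive : ∀ n {r} → r < fib n → 0 < fib (suc n) + r
cons-positive zero    ()
cons-positive (suc n) {r} _ = <-≤-trans (fib-suc-pos (suc n)) (m≤m+n _ r)

cons-<-fib : ∀ {n r m} → r < fib n → suc n < m → fib (suc n) + r < fib m
cons-<-fib {n} p 1+n<m = <-≤-trans (+-monoʳ-< (fib (suc n)) p) (fib-mono-≤ 1+n<m)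

cons-index-injective : ∀ {n m r s} → fib (suc n) + r ≡ fib (suc m) + s →
                       r < fib n → s < fib m → n ≡ m
cons-index-injective {n} {m} {r} {s} e p q with <-cmp n m
... | tri< n<m _ _ = ⊥-elim (<-irrefl e (<-≤-trans (cons-<-fib p (s≤s n<m)) (m≤m+n _ s)))
... | tri≈ _ n≡m _ = n≡m
... | tri> _ _ m<n = ⊥-elim (<-irrefl (sym e) (<-≤-trans (cons-<-fib q (s≤s m<n)) (m≤m+n _ r)))

zeck-of-zero : ∀ {x k} → Zeckendorf x k → x ≡ 0 → k ≡ 0
zeck-of-zero empty          _ = refl
zeck-of-zero (cons {n} p _) e = ⊥-elim (<-irrefl (sym e) (cons-positive n p))

zeck-uncons : ∀ {x k n s} → Zeckendorf x k → x ≡ fib (suc n) + s → s < fib n →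
              Σ ℕ λ k′ → Zeckendorf s k′ × k ≡ suc k′
zeck-uncons {n = n} empty e q = ⊥-elim (<-irrefl e (cons-positive n q))
zeck-uncons {n = m} {s} (cons {n} {r} p z) e q with cons-index-injective {n} {m} {r} {s} e p q
... | refl = _ , zeck-cast (+-cancelˡ-≡ _ _ _ e) z , refl

zeck-unique : ∀ {x k k′} → Zeckendorf x k → Zeckendorf x k′ → k ≡ k′
zeck-unique empty z′ = sym (zeck-of-zero z′ refl)
zeck-unique (cons {n} p z) z′ with zeck-uncons {n = n} z′ refl p
... | _ , z″ , refl = cong suc (zeck-unique z z″)

Zeckendorf≤ : ℕ → ℕ → Set
Zeckendorf≤ x b = Σ ℕ λ k → Zeckendorf x k × k ≤ b

zeck≤-weaken : ∀ {x b c} → b ≤ c → Zeckendorf≤ x b → Zeckendorf≤ x c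
zeck≤-weaken b≤c (k , z , k≤b) = k , z , ≤-trans k≤b b≤c

zeck≤-cast : ∀ {x y b} → x ≡ y → Zeckendorf≤ x b → Zeckendorf≤ y b
zeck≤-cast e (k , z , k≤b) = k , zeck-cast e z , k≤b

zeck-fib : ∀ i → Zeckendorf≤ (fib i) 1
zeck-fib zero          = 0 , empty , z≤n
zeck-fib (suc zero)    = 1 , cons {n = 1} (s≤s z≤n) empty , ≤-refl
zeck-fib (suc (suc i)) = 1 , zeck-cast (+-identityʳ _) (cons {suc i} (fib-suc-pos i) empty) , ≤-refl

data Position (n : ℕ) : ℕ → Set where
  below : ∀ {i} → i < n → Position n i
  same  : Position n n
  next  : Position n (suc n)
  next² : Position n (suc (suc n))
  far   : ∀ {j} → suc n < j → Position n (suc j)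

position : ∀ n i → Position n i
position zero    zero                = same
position zero    (suc zero)          = next
position zero    (suc (suc zero))    = next²
position zero    (suc (suc (suc j))) = far (s≤s (s≤s z≤n))
position (suc n) zero                = below (s≤s z≤n)
position (suc n) (suc i) with position n i
... | below i<n   = below (s≤s i<n)
... | same        = same
... | next        = next
... | next²       = next²
... | far 1+n<j   = far (s≤s 1+n<j)

zeck-+-fib-same : ∀ n {r k} → r < fib n → Zeckendorf r k →
                  Zeckendorf (fib (suc n) + r + fib n) (suc k)
zeck-+-fib-same n {r} p z =
  zeck-cast (swap (fib (suc n)) (fib n) r) (cons {suc n} (<-≤-trans p (fib-≤-suc n)) z)
  where
  swap : ∀ u v w → u + v + w ≡ u + w + v
  swap = solve-∀

zeck-+-fib-next : ∀ n {r b} → r < fib (suc n) → Zeckendorf≤ (r + fib n) b →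
                  Zeckendorf≤ (fib (suc (suc n)) + r + fib (suc (suc n))) (suc b)
zeck-+-fib-next n {r} p (k , z , k≤b) =
  suc k , zeck-cast (double (fib (suc n)) (fib n) r) (cons {suc (suc n)} (+-monoˡ-< (fib n) p) z) ,
  s≤s k≤b
  where
  double : ∀ u v w → u + v + u + (w + v) ≡ u + v + w + (u + v)
  double = solve-∀

zeck-+-fib-next² : ∀ n {r k} → r < fib n → Zeckendorf r k →
                   Zeckendorf (fib (suc n) + r + fib (suc (suc n))) (suc k)
zeck-+-fib-next² n {r} p z =
  zeck-cast (rotate (fib (suc n)) (fib n) r)
            (cons {suc (suc n)} (<-≤-trans p (fib-mono-≤ (m≤n+m n 2))) z)
  where
  rotate : ∀ u v w → u + v + u + w ≡ u + w + (u + v)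
  rotate = solve-∀

zeck-+-fib-far : ∀ n {r k j} → r < fib n → suc n < j → Zeckendorf r k →
                 Zeckendorf (fib (suc n) + r + fib (suc j)) (suc (suc k))
zeck-+-fib-far n {j = j} p 1+n<j z =
  zeck-cast (+-comm (fib (suc j)) _) (cons {j} (cons-<-fib {n} p 1+n<j) (cons {n} p z))

cons-overflow : ∀ {n r i} → r < fib (suc n) → i ≤ n → fib (suc n) ≤ r + fib i →
                r + fib i ∸ fib (suc n) < fib n
cons-overflow {n} {r} {i} p i≤n overflow = <-≤-trans s<fib-i (fib-mono-≤ i≤n)
  where
  open ≤-Reasoning
  s<fib-i : r + fib i ∸ fib (suc n) < fib i
  s<fib-i = +-cancelˡ-< (fib (suc n)) _ (fib i) (begin-strict
    fib (suc n) + (r + fib i ∸ fib (suc n)) ≡⟨ m+[n∸m]≡n overflow ⟩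
    r + fib i                               <⟨ +-monoˡ-< (fib i) p ⟩
    fib (suc n) + fib i                     ∎)

-- Since fib (suc n) ≤ r + fib i < fib (suc (suc n)), the expansion of r + fib i starts
-- with fib (suc n), which merges with the leading fib (suc (suc n)): no term is added.
zeck-+-fib-carry : ∀ {n r i k} → r < fib (suc n) → i ≤ n → fib (suc n) ≤ r + fib i →
                   Zeckendorf (r + fib i) k → Zeckendorf (fib (suc (suc n)) + r + fib i) k
zeck-+-fib-carry {n} {r} {i} p i≤n overflow z
  with zeck-uncons {n = n} z (sym (m+[n∸m]≡n overflow)) (cons-overflow p i≤n overflow)
... | _ , z′ , refl =
  zeck-cast merge
    (cons {suc (suc n)} (<-≤-trans (cons-overflow p i≤n overflow) (fib-mono-≤ (m≤n+m n 2))) z′)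
  where
  open ≡-Reasoning
  s : ℕ
  s = r + fib i ∸ fib (suc n)
  merge : fib (suc (suc (suc n))) + s ≡ fib (suc (suc n)) + r + fib i
  merge = begin
    fib (suc (suc n)) + fib (suc n) + s   ≡⟨ +-assoc (fib (suc (suc n))) (fib (suc n)) s ⟩
    fib (suc (suc n)) + (fib (suc n) + s) ≡⟨ cong (fib (suc (suc n)) +_) (m+[n∸m]≡n overflow) ⟩
    fib (suc (suc n)) + (r + fib i)       ≡⟨ +-assoc (fib (suc (suc n))) r (fib i) ⟨
    fib (suc (suc n)) + r + fib i         ∎

zeck-+-fib-below : ∀ {n r i b} → r < fib n → i < n → Zeckendorf≤ (r + fib i) b →
                   Zeckendorf≤ (fib (suc n) + r + fib i) (suc b)
zeck-+-fib-below {suc n} {r} {i} p i<n (k , z , k≤b) with r + fib i <? fib (suc n)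
... | yes fits     = suc k , zeck-cast (sym (+-assoc _ r (fib i))) (cons {suc n} fits z) , s≤s k≤b
... | no overflows = k , zeck-+-fib-carry p (s≤s⁻¹ i<n) (≮⇒≥ overflows) z , m≤n⇒m≤1+n k≤b

zeck-+-fib : ∀ {x k} → Zeckendorf x k → ∀ i → Zeckendorf≤ (x + fib i) (suc k)
zeck-+-fib empty i = zeck-fib i
zeck-+-fib (cons {zero} () _) _
zeck-+-fib (cons {suc n} p z) i with position (suc n) i
... | below i<n = zeck-+-fib-below p i<n (zeck-+-fib z i)
... | same      = _ , zeck-+-fib-same (suc n) p z , n≤1+n _
... | next      = zeck-+-fib-next n p (zeck-+-fib z n)
... | next²     = _ , zeck-+-fib-next² (suc n) p z , n≤1+n _
... | far 1+n<j = _ , zeck-+-fib-far (suc n) p 1+n<j z , ≤-refl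

zeck-+-multiple : ∀ {x b} → Zeckendorf≤ x b → ∀ c i → Zeckendorf≤ (c * fib i + x) (c + b)
zeck-+-multiple z zero    i = z
zeck-+-multiple z (suc c) i with zeck-+-multiple z c i
... | k , z′ , k≤ = zeck≤-cast (trans (+-comm _ (fib i)) (sym (+-assoc (fib i) _ _)))
                               (zeck≤-weaken (s≤s k≤) (zeck-+-fib z′ i))

zeck-valueFrom : ∀ j {m} (bs : Vec ℕ m) → Zeckendorf≤ (valueFrom j bs) (weight bs)
zeck-valueFrom j []       = 0 , empty , z≤n
zeck-valueFrom j (b ∷ bs) = zeck-+-multiple (zeck-valueFrom (suc j) bs) b j

Representation : ℕ → ℕ → Set
Representation x k =
  Σ ℕ λ m → Σ (Vec ℕ (suc m)) λ bs → (valueFrom 2 bs ≡ x) × (weight bs ≡ k)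

incrementAt : ∀ {m} (d : ℕ) → Vec ℕ m → Vec ℕ (suc d ⊔ m)
incrementAt zero    []       = 1 ∷ []
incrementAt zero    (b ∷ bs) = suc b ∷ bs
incrementAt (suc d) []       = 0 ∷ incrementAt d []
incrementAt (suc d) (b ∷ bs) = b ∷ incrementAt d bs

valueFrom-incrementAt : ∀ {m} j d (bs : Vec ℕ m) →
                        valueFrom j (incrementAt d bs) ≡ fib (j + d) + valueFrom j bs
valueFrom-incrementAt j zero [] =
  cong (_+ 0) (trans (*-identityˡ (fib j)) (cong fib (sym (+-identityʳ j))))
valueFrom-incrementAt j zero (b ∷ bs) =
  trans (+-assoc (fib j) (b * fib j) (valueFrom (suc j) bs))
        (cong (λ t → fib t + (b * fib j + valueFrom (suc j) bs)) (sym (+-identityʳ j)))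
valueFrom-incrementAt j (suc d) [] =
  trans (valueFrom-incrementAt (suc j) d []) (cong (λ t → fib t + 0) (sym (+-suc j d)))
valueFrom-incrementAt j (suc d) (b ∷ bs) = begin
  b * fib j + valueFrom (suc j) (incrementAt d bs) ≡⟨ cong (b * fib j +_) (valueFrom-incrementAt (suc j) d bs) ⟩
  b * fib j + (fib (suc (j + d)) + v)             ≡⟨ x+[y+z]≡y+[x+z] (b * fib j) (fib (suc (j + d))) v ⟩
  fib (suc (j + d)) + (b * fib j + v)             ≡⟨ cong (λ t → fib t + (b * fib j + v)) (+-suc j d) ⟨
  fib (j + suc d) + (b * fib j + v)               ∎
  where
  open ≡-Reasoning
  v : ℕ
  v = valueFrom (suc j) bs
  x+[y+z]≡y+[x+z] : ∀ x y z → x + (y + z) ≡ y + (x + z)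
  x+[y+z]≡y+[x+z] = solve-∀

weight-incrementAt : ∀ {m} d (bs : Vec ℕ m) → weight (incrementAt d bs) ≡ suc (weight bs)
weight-incrementAt zero    []       = refl
weight-incrementAt zero    (b ∷ bs) = refl
weight-incrementAt (suc d) []       = weight-incrementAt d []
weight-incrementAt (suc d) (b ∷ bs) = trans (cong (b +_) (weight-incrementAt d bs)) (+-suc b _)

zeck-representation : ∀ {x k} → Zeckendorf x k → Representation x k
zeck-representation empty = 0 , 0 ∷ [] , refl , refl
zeck-representation (cons {zero} () _)
zeck-representation (cons {suc n} _ z) with zeck-representation z
... | m , bs , value≡ , weight≡ =
  n ⊔ m , incrementAt n bs ,
  trans (valueFrom-incrementAt 2 n bs) (cong (fib (suc (suc n)) +_) value≡) ,
  trans (weight-incrementAt n bs) (cong suc weight≡)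

zeck-isBeta : ∀ {x k} → Zeckendorf x k → IsBeta x k
zeck-isBeta {x} {k} z = zeck-representation z , minimal
  where
  minimal : ∀ m (bs : Vec ℕ (suc m)) → valueFrom 2 bs ≡ x → k ≤ weight bs
  minimal _ bs value≡ with zeck-valueFrom 2 bs
  ... | _ , z′ , k′≤w = subst (_≤ weight bs) (zeck-unique (zeck-cast value≡ z′) z) k′≤w

zeck-fib-pred : ∀ a → Zeckendorf (fib a ∸ 1) ((a ∸ 1) / 2)
zeck-fib-pred zero             = empty
zeck-fib-pred (suc zero)       = empty
zeck-fib-pred (suc (suc zero)) = empty
zeck-fib-pred (suc (suc (suc a))) =
  subst₂ Zeckendorf (sym (+-∸-assoc (fib (suc (suc a))) (fib-suc-pos a)))
                    (sym (m/n≡1+[m∸n]/n {suc (suc a)} {2} (s≤s (s≤s z≤n))))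
    (cons {suc a} (∸-monoʳ-< {fib (suc a)} (s≤s z≤n) (fib-suc-pos a)) (zeck-fib-pred (suc a)))

lemma21 : (a : ℕ) → a ≢ 0 → IsBeta (fib a ∸ 1) ((a ∸ 1) / 2)
lemma21 a _ = zeck-isBeta (zeck-fib-pred a)
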